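{- Let $P$ be a naturally labeled poset on $[n]$ with antiadjacency matrix $A_P=(a_{i,j})$, and let $f=(1,f_0,f_1,\dots,f_{n-1})$ be its $f$-vector. Then $f_0=n$, and for each $k\ge 1$, $f_k$ equals the number of valley Dyck paths of $A_P$ having exactly $k$ peaks.
   Context: A poset labeled bijectively by $[n]$ is naturally labeled if $i\le_P j$ implies $i\le j$ as integers. Its antiadjacency matrix is the $n\times n$ $0/1$ matrix $(a_{i,j})$ with $a_{i,j}=0$ iff $i<_P j$. The $f$-vector of $P$ is $(1,f_0,\dots,f_{n-1})$ where $f_k$ is the number of $(k+1)$-element chains of $P$. A valley Dyck path of $A_P$ is a lattice path drawn on the positions $(r,c)$ of the matrix, consisting of east steps $(r,c)\to(r,c+1)$ and south steps $(r,c)\to(r+1,c)$, that is a Dyck path with respect to the main diagonal, begins and ends at diagonal positions $(i,i)$, has all its valleys (south-then-east turns) on the main diagonal, and has all its peaks (east-then-south turns) at positions $(i,j)$ with $a_{i,j}=0$. -}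

module Defs where

open import Level using (0ℓ)
open import Data.Nat using (ℕ; zero; suc; _+_; _*_; _≤_; _≡ᵇ_; _≤ᵇ_)
import Data.Nat as ℕ
open import Data.Bool using (Bool; true; false; _∧_; _∨_; not; if_then_else_)
open import Data.Fin using (Fin; toℕ)
open import Data.Fin.Properties using (all?)
open import Data.Fin.Subset using (Subset; _∈_; ∣_∣)
open import Data.Fin.Subset.Properties using (_∈?_)
open import Data.Vec using ([]; _∷_)
open import Data.List using (List; []; _∷_; [_]; map; concatMap; length; filter; filterᵇ; allFin; cartesianProduct)
open import Data.Product using (_×_; _,_; proj₁; proj₂)
open import Data.Sum using (_⊎_)
open import Relation.Binary using (Rel; IsDecPartialOrder)
open import Relation.Binary.PropositionalEquality using (_≡_)
open import Relation.Nullary using (¬_; Dec; does)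
open import Relation.Nullary.Decidable using (_×-dec_; _⊎-dec_; _→-dec_; ¬?)

-- Naturally labeled posets on [n]  (the label i ∈ [n] is Fin n, i.e. i-1)

record NatLabeledPoset (n : ℕ) : Set₁ where
  field
    _≤P_     : Rel (Fin n) 0ℓ
    isDecPO  : IsDecPartialOrder _≡_ _≤P_
    natural  : ∀ {i j} → i ≤P j → toℕ i ≤ toℕ j

  open IsDecPartialOrder isDecPO public using (_≟_; _≤?_)

  _<P_ : Rel (Fin n) 0ℓ
  i <P j = i ≤P j × ¬ (i ≡ j)

  _<P?_ : ∀ i j → Dec (i <P j)
  i <P? j = (i ≤? j) ×-dec ¬? (i ≟ j)

  antiadj : Fin n → Fin n → ℕ
  antiadj i j = if does (i <P? j) then 0 else 1

  IsChain : Subset n → Set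
  IsChain S = ∀ i j → i ∈ S → j ∈ S → (i ≤P j) ⊎ (j ≤P i)

  isChain? : ∀ S → Dec (IsChain S)
  isChain? S = all? λ i → all? λ j →
    (i ∈? S) →-dec ((j ∈? S) →-dec ((i ≤? j) ⊎-dec (j ≤? i)))

allSubsets : (n : ℕ) → List (Subset n)
allSubsets zero    = [ [] ]
allSubsets (suc n) = concatMap (λ S → (true ∷ S) ∷ (false ∷ S) ∷ []) (allSubsets n)

module _ {n : ℕ} (P : NatLabeledPoset n) where
  open NatLabeledPoset P

  numChains : ℕ → ℕ
  numChains m = length (filter (λ S → (∣ S ∣ ℕ.≟ m) ×-dec isChain? S) (allSubsets n))

  -- the f-vector (1, f_0, ..., f_{n-1}):  f_k = number of (k+1)-element chains
  fvec : ℕ → ℕ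
  fvec k = numChains (suc k)

Pos : ℕ → Set
Pos n = Fin n × Fin n

module _ {n : ℕ} where

  isEast : Pos n → Pos n → Bool
  isEast (r , c) (r′ , c′) = (toℕ r′ ≡ᵇ toℕ r) ∧ (toℕ c′ ≡ᵇ suc (toℕ c))

  isSouth : Pos n → Pos n → Bool
  isSouth (r , c) (r′ , c′) = (toℕ r′ ≡ᵇ suc (toℕ r)) ∧ (toℕ c′ ≡ᵇ toℕ c)

  onDiag : Pos n → Bool
  onDiag (r , c) = toℕ r ≡ᵇ toℕ c

  aboveDiag : Pos n → Bool
  aboveDiag (r , c) = toℕ r ≤ᵇ toℕ c

  stepsOK : List (Pos n) → Bool
  stepsOK (p ∷ q ∷ ps) = (isEast p q ∨ isSouth p q) ∧ stepsOK (q ∷ ps)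
  stepsOK _            = true

  allAbove : List (Pos n) → Bool
  allAbove []       = true
  allAbove (p ∷ ps) = aboveDiag p ∧ allAbove ps

  lastPos : Pos n → List (Pos n) → Pos n
  lastPos p []       = p
  lastPos p (q ∷ ps) = lastPos q ps

  endsOnDiag : List (Pos n) → Bool
  endsOnDiag []       = false
  endsOnDiag (p ∷ ps) = onDiag p ∧ onDiag (lastPos p ps)

  isValley isPeak : Pos n → Pos n → Pos n → Bool
  isValley p q s = isSouth p q ∧ isEast q s
  isPeak   p q s = isEast p q ∧ isSouth q s

  turnsOK : (Fin n → Fin n → ℕ) → List (Pos n) → Bool
  turnsOK M (p ∷ q ∷ s ∷ ps) =
    (not (isValley p q s) ∨ onDiag q) ∧
    (not (isPeak p q s) ∨ (M (proj₁ q) (proj₂ q) ≡ᵇ 0)) ∧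
    turnsOK M (q ∷ s ∷ ps)
  turnsOK M _ = true

  numPeaks : List (Pos n) → ℕ
  numPeaks (p ∷ q ∷ s ∷ ps) = (if isPeak p q s then 1 else 0) + numPeaks (q ∷ s ∷ ps)
  numPeaks _ = 0

  isValleyDyck : (Fin n → Fin n → ℕ) → List (Pos n) → Bool
  isValleyDyck M π = endsOnDiag π ∧ stepsOK π ∧ allAbove π ∧ turnsOK M π

listsUpTo : {A : Set} → ℕ → List A → List (List A)
listsUpTo zero    xs = [ [] ]
listsUpTo (suc m) xs = [] ∷ concatMap (λ x → map (x ∷_) (listsUpTo m xs)) xs

allPos : (n : ℕ) → List (Pos n)
allPos n = cartesianProduct (allFin n) (allFin n)

-- number of valley Dyck paths of M with exactly k peaks.  Any such path
-- visits at most 2n-1 positions, so enumerating lists of length ≤ 2n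
-- of positions enumerates every such path exactly once.
numValleyDyck : {n : ℕ} → (Fin n → Fin n → ℕ) → ℕ → ℕ
numValleyDyck {n} M k =
  length (filterᵇ (λ π → isValleyDyck M π ∧ (numPeaks π ≡ᵇ k)) (listsUpTo (2 * n) (allPos n)))

module Submission where

-- The proof is a bijection.  A (k+1)-chain a₀ < ... < a_k goes to the path
-- from (a₀ , a₀) running, for each j, east along row a_j to (a_j , a_{j+1})
-- and south to (a_{j+1} , a_{j+1}); its valleys are diagonal and its k
-- peaks (a_j , a_{j+1}) are zeros of A_P as a_j <_P a_{j+1}.  Conversely a
-- valley Dyck path is determined by its diagonal cells, and consecutive
-- ones a < b have a zero of A_P at the peak (a , b), so a <_P b.

open import Defs
open import Data.Nat using (ℕ; zero; suc; _+_; _*_; _∸_; _≤_; _<_; _≡ᵇ_; z≤n; s≤s; NonZero; _≟_; _≤?_; _<?_)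
import Data.Nat.Properties as ℕ
open import Data.Nat.Properties using (+-suc; ≤-refl; m∸n+n≡m; m+n∸n≡m; m≤n⇒m<n∨m≡n)
open import Data.Nat.DivMod using (_mod_; m%n<n; m<n⇒m%n≡m)
open import Data.Bool using (T; true; false; not; _∧_; _∨_; if_then_else_)
open import Data.Bool.Properties using (T-≡; T-∧)
open import Data.Fin using (Fin; toℕ) renaming (zero to fzero; suc to fsuc)
open import Data.Fin.Properties using (toℕ-injective; toℕ<n; toℕ-fromℕ<)
open import Data.Fin.Subset using (Subset; ∣_∣) renaming (_∈_ to _∈ₛ_)
open import Data.Fin.Subset.Properties using (⊆-antisym)
open import Data.Vec using ([]; _∷_; here; there; tabulate)
open import Data.Vec.Properties using ([]=⇒lookup; lookup⇒[]=; lookup∘tabulate)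
open import Data.List using (List; []; _∷_; length; map; filter; concatMap; upTo; head)
open import Data.List.Properties
  using (length-map; map-∘; map-id-local; ∷-injectiveˡ; ∷-injectiveʳ; filter-accept; filter-reject; filter-all; length-upTo)
open import Data.List.Membership.Propositional using (_∈_)
open import Data.List.Membership.Propositional.Properties
  using ( ∈-filter⁺; ∈-filter⁻; ∈-map⁺; ∈-map⁻; ∈-concatMap⁺; ∈-concatMap⁻
        ; ∈-cartesianProduct⁺; ∈-allFin; ∈-upTo⁺; ∈-upTo⁻)
open import Data.List.Membership.Propositional.Properties.WithK using (unique∧set⇒bag)
open import Data.List.Membership.DecPropositional _≟_ using (_∈?_)
open import Data.List.Relation.Unary.Any as Any using (here; there)
open import Data.List.Relation.Unary.All as All using (All; []; _∷_)
import Data.List.Relation.Unary.All.Properties as Allₚ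
open import Data.List.Relation.Unary.AllPairs as AllPairs using (AllPairs; []; _∷_)
import Data.List.Relation.Unary.AllPairs.Properties as AllPairsₚ
open import Data.List.Relation.Unary.Linked as Linked using (Linked; []; [-]; _∷_)
open import Data.List.Relation.Unary.Linked.Properties using (AllPairs⇒Linked; Linked⇒AllPairs)
open import Data.List.Relation.Unary.Unique.Propositional using (Unique)
import Data.List.Relation.Unary.Unique.Propositional.Properties as Unique
open import Data.List.Relation.Unary.Sorted.TotalOrder.Properties using (↗↭↗⇒≋)
open import Data.List.Relation.Binary.BagAndSetEquality using (∼bag⇒↭)
open import Data.List.Relation.Binary.Permutation.Propositional using (↭⇒↭ₛ)
open import Data.List.Relation.Binary.Permutation.Propositional.Properties using (↭-length)
open import Data.List.Relation.Binary.Pointwise using (Pointwise-≡⇒≡)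
open import Data.Maybe using (fromMaybe)
open import Data.Product using (Σ; ∃; ∃₂; _×_; _,_; proj₁; proj₂)
open import Data.Sum using (_⊎_; inj₁; inj₂)
open import Data.Unit using (⊤; tt)
open import Data.Empty using (⊥)
open import Function.Base using (_∘_)
open import Function.Bundles using (Equivalence; mk⇔; _⇔_)
open import Relation.Nullary using (¬_; Dec; yes; no; does; isYes; contradiction)
open import Relation.Nullary.Decidable
  using (_×-dec_; _⊎-dec_; _→-dec_; toWitness; fromWitness; isYes≗does; dec-true; dec-false)
open import Relation.Unary using (Decidable)
open import Relation.Binary using (IsDecPartialOrder)
open import Relation.Binary.PropositionalEquality

T-does : ∀ {A : Set} (d : Dec A) → T (does d) ⇔ A
T-does {A} d = subst (λ b → T b ⇔ A) (isYes≗does d) (mk⇔ toWitness fromWitness)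

allPairs-related : ∀ {A : Set} {R : A → A → Set} {xs x y} → AllPairs R xs → x ∈ xs → y ∈ xs → x ≡ y ⊎ R x y ⊎ R y x
allPairs-related (_   ∷ _)   (here refl) (here refl) = inj₁ refl
allPairs-related (Rx ∷ _)    (here refl) (there y∈)  = inj₂ (inj₁ (All.lookup Rx y∈))
allPairs-related (Rx ∷ _)    (there x∈)  (here refl) = inj₂ (inj₂ (All.lookup Rx x∈))
allPairs-related (_  ∷ Rxs)  (there x∈)  (there y∈)  = allPairs-related Rxs x∈ y∈

increasing-ext : ∀ {xs ys} → AllPairs _<_ xs → AllPairs _<_ ys →
  (∀ {x} → x ∈ xs → x ∈ ys) → (∀ {x} → x ∈ ys → x ∈ xs) → xs ≡ ys
increasing-ext xs↑ ys↑ xs⊆ys ys⊆xs = Pointwise-≡⇒≡ (↗↭↗⇒≋ ℕ.≤-totalOrder (sorted xs↑) (sorted ys↑)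
  (↭⇒↭ₛ (∼bag⇒↭ (unique∧set⇒bag (AllPairs.map ℕ.<⇒≢ xs↑) (AllPairs.map ℕ.<⇒≢ ys↑) (mk⇔ xs⊆ys ys⊆xs)))))
  where
  sorted : ∀ {zs} → AllPairs _<_ zs → Linked _≤_ zs
  sorted zs↑ = AllPairs⇒Linked (AllPairs.map ℕ.<⇒≤ zs↑)

-- The f-image of the P-part is
-- duplicate-free with the same members as the Q-part, hence a
-- permutation of it.
count-bijection : {A B : Set} {P : A → Set} {Q : B → Set} (P? : Decidable P) (Q? : Decidable Q)
  {xs : List A} {ys : List B} → Unique xs → Unique ys → (f : A → B) (g : B → A) →
  (∀ {x} → x ∈ xs → P x → f x ∈ ys × Q (f x) × g (f x) ≡ x) →
  (∀ {y} → y ∈ ys → Q y → g y ∈ xs × P (g y) × f (g y) ≡ y) →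
  length (filter P? xs) ≡ length (filter Q? ys)
count-bijection {Q = Q} P? Q? {xs} {ys} xs! ys! f g f-ok g-ok = begin
  length (filter P? xs)         ≡⟨ length-map f (filter P? xs) ⟨
  length (map f (filter P? xs)) ≡⟨ ↭-length (∼bag⇒↭ (unique∧set⇒bag image! (Unique.filter⁺ Q? ys!) (mk⇔ into onto))) ⟩
  length (filter Q? ys)         ∎
  where
  open ≡-Reasoning
  ok : ∀ {x} → x ∈ filter P? xs → f x ∈ ys × Q (f x) × g (f x) ≡ x
  ok x∈ = let x∈xs , px = ∈-filter⁻ P? x∈ in f-ok x∈xs px
  -- g undoes f on the selected elements, so f does not identify any of them
  g∘f : map g (map f (filter P? xs)) ≡ filter P? xs
  g∘f = trans (sym (map-∘ (filter P? xs))) (map-id-local (All.tabulate (λ x∈ → proj₂ (proj₂ (ok x∈)))))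
  image! : Unique (map f (filter P? xs))
  image! = Unique.map⁻ (subst Unique (sym g∘f) (Unique.filter⁺ P? xs!))
  into : ∀ {y} → y ∈ map f (filter P? xs) → y ∈ filter Q? ys
  into y∈ with _ , x∈ , refl ← ∈-map⁻ f y∈ = ∈-filter⁺ Q? (proj₁ (ok x∈)) (proj₁ (proj₂ (ok x∈)))
  onto : ∀ {y} → y ∈ filter Q? ys → y ∈ map f (filter P? xs)
  onto y∈ with y∈ys , qy ← ∈-filter⁻ Q? y∈ with gy∈xs , pgy , fgy≡y ← g-ok y∈ys qy =
    subst (_∈ map f (filter P? xs)) fgy≡y (∈-map⁺ f (∈-filter⁺ P? gy∈xs pgy))

concatMap-unique : {A B : Set} (f : A → List B) {xs : List A} → Unique xs →
  (∀ x → Unique (f x)) → (∀ {x y v} → v ∈ f x → v ∈ f y → x ≡ y) → Unique (concatMap f xs)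
concatMap-unique f xs! f! separated = Unique.concat⁺ (Allₚ.map⁺ (All.universal f! _))
  (AllPairsₚ.map⁺ (AllPairs.map (λ x≢y {_} (v∈fx , v∈fy) → x≢y (separated v∈fx v∈fy)) xs!))

allSubsets-complete : ∀ n (S : Subset n) → S ∈ allSubsets n
allSubsets-complete zero    []      = here refl
allSubsets-complete (suc n) (b ∷ S) =
  ∈-concatMap⁺ _ (Any.map (λ { refl → extend b }) (allSubsets-complete n S))
  where
  extend : ∀ b → (b ∷ S) ∈ (true ∷ S) ∷ (false ∷ S) ∷ []
  extend true  = here refl
  extend false = there (here refl)

allSubsets-unique : ∀ n → Unique (allSubsets n)
allSubsets-unique zero    = [] ∷ []
allSubsets-unique (suc n) = concatMap-unique _ (allSubsets-unique n) (λ _ → ((λ ()) ∷ []) ∷ [] ∷ []) same-tail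
  where
  same-tail : ∀ {S T : Subset n} {v} → v ∈ (true ∷ S) ∷ (false ∷ S) ∷ [] →
              v ∈ (true ∷ T) ∷ (false ∷ T) ∷ [] → S ≡ T
  same-tail (here refl)         (here refl)         = refl
  same-tail (there (here refl)) (there (here refl)) = refl
  same-tail (here refl)         (there (here ()))
  same-tail (there (here refl)) (here ())

listsUpTo-complete : {A : Set} (m : ℕ) (xs l : List A) → length l ≤ m → All (_∈ xs) l → l ∈ listsUpTo m xs
listsUpTo-complete zero    xs []      _         _          = here refl
listsUpTo-complete (suc m) xs []      _         _          = here refl
listsUpTo-complete (suc m) xs (y ∷ l) (s≤s |l|≤m) (y∈ ∷ l⊆) =
  there (∈-concatMap⁺ _ (Any.map (λ { refl → ∈-map⁺ (y ∷_) (listsUpTo-complete m xs l |l|≤m l⊆) }) y∈))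

listsUpTo-unique : {A : Set} (m : ℕ) {xs : List A} → Unique xs → Unique (listsUpTo m xs)
listsUpTo-unique zero         xs! = [] ∷ []
listsUpTo-unique {A} (suc m) {xs} xs! =
  All.tabulate nonempty ∷ concatMap-unique prefixed xs! (λ _ → Unique.map⁺ ∷-injectiveʳ (listsUpTo-unique m xs!)) same-head
  where
  prefixed : A → List (List A)
  prefixed x = map (x ∷_) (listsUpTo m xs)
  same-head : ∀ {x y v} → v ∈ prefixed x → v ∈ prefixed y → x ≡ y
  same-head v∈ v∈′ with _ , _ , refl ← ∈-map⁻ _ v∈ with _ , _ , eq ← ∈-map⁻ _ v∈′ = ∷-injectiveˡ eq
  nonempty : ∀ {v} → v ∈ concatMap prefixed xs → ¬ [] ≡ v
  nonempty v∈ []≡v with _ , v∈′ ← Any.satisfied (∈-concatMap⁻ prefixed {xs = xs} v∈)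
                   with _ , _ , refl ← ∈-map⁻ _ v∈′ with () ← []≡v

allPos-complete : ∀ n (p : Pos n) → p ∈ allPos n
allPos-complete n (r , c) = ∈-cartesianProduct⁺ (∈-allFin r) (∈-allFin c)

allPos-unique : ∀ n → Unique (allPos n)
allPos-unique n = Unique.cartesianProduct⁺ (Unique.allFin⁺ n) (Unique.allFin⁺ n)

elements : ∀ {n} → Subset n → List ℕ
elements []          = []
elements (true  ∷ S) = 0 ∷ map suc (elements S)
elements (false ∷ S) = map suc (elements S)

∈-elements⁺ : ∀ {n} {S : Subset n} {i} → i ∈ₛ S → toℕ i ∈ elements S
∈-elements⁺ {S = true  ∷ S} here      = here refl
∈-elements⁺ {S = true  ∷ S} (there p) = there (∈-map⁺ suc (∈-elements⁺ p))
∈-elements⁺ {S = false ∷ S} (there p) = ∈-map⁺ suc (∈-elements⁺ p)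

∈-elements⁻ : ∀ {n} (S : Subset n) {x} → x ∈ elements S → Σ (Fin n) λ i → toℕ i ≡ x × i ∈ₛ S
∈-elements⁻ (true ∷ S) (here refl) = fzero , refl , here
∈-elements⁻ (true ∷ S) (there x∈) with _ , y∈ , refl ← ∈-map⁻ suc x∈ with i , refl , i∈ ← ∈-elements⁻ S y∈ =
  fsuc i , refl , there i∈
∈-elements⁻ (false ∷ S) x∈ with _ , y∈ , refl ← ∈-map⁻ suc x∈ with i , refl , i∈ ← ∈-elements⁻ S y∈ =
  fsuc i , refl , there i∈

elements-bounded : ∀ {n} (S : Subset n) → All (_< n) (elements S)
elements-bounded S = All.tabulate λ x∈ → let i , i≡x , _ = ∈-elements⁻ S x∈ in subst (_< _) i≡x (toℕ<n i)

elements-increasing : ∀ {n} (S : Subset n) → AllPairs _<_ (elements S)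
elements-increasing []          = []
elements-increasing (true  ∷ S) =
  Allₚ.map⁺ (All.universal (λ _ → s≤s z≤n) (elements S)) ∷ AllPairsₚ.map⁺ (AllPairs.map s≤s (elements-increasing S))
elements-increasing (false ∷ S) = AllPairsₚ.map⁺ (AllPairs.map s≤s (elements-increasing S))

size-elements : ∀ {n} (S : Subset n) → ∣ S ∣ ≡ length (elements S)
size-elements []          = refl
size-elements (true  ∷ S) = cong suc (trans (size-elements S) (sym (length-map suc (elements S))))
size-elements (false ∷ S) = trans (size-elements S) (sym (length-map suc (elements S)))

sized-elements : ∀ {n k} (S : Subset n) → ∣ S ∣ ≡ suc k → ∃₂ λ a L → elements S ≡ a ∷ L × length L ≡ k
sized-elements S |S|≡1+k with elements S | size-elements S
... | []    | |S|≡0     with () ← trans (sym |S|≡0) |S|≡1+k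
... | a ∷ L | |S|≡1+|L| = a , L , refl , ℕ.suc-injective (trans (sym |S|≡1+|L|) |S|≡1+k)

size-one : ∀ {n} (S : Subset n) → ∣ S ∣ ≡ 1 → ∃ λ x → elements S ≡ x ∷ []
size-one S |S|≡1 with sized-elements S |S|≡1
... | x , []    , elements≡ , _  = x , elements≡
... | x , _ ∷ _ , _         , ()

fromList : ∀ {n} → List ℕ → Subset n
fromList D = tabulate λ i → isYes (toℕ i ∈? D)

∈-fromList⁺ : ∀ {n} {i : Fin n} {D} → toℕ i ∈ D → i ∈ₛ fromList D
∈-fromList⁺ {i = i} x∈ = lookup⇒[]= i _ (trans (lookup∘tabulate _ i) (Equivalence.to T-≡ (fromWitness x∈)))

∈-fromList⁻ : ∀ {n} {i : Fin n} {D} → i ∈ₛ fromList D → toℕ i ∈ D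
∈-fromList⁻ {i = i} i∈ = toWitness (Equivalence.from T-≡ (trans (sym (lookup∘tabulate _ i)) ([]=⇒lookup i∈)))

fromList-elements : ∀ {n} (S : Subset n) → fromList (elements S) ≡ S
fromList-elements S = ⊆-antisym into (λ i∈ → ∈-fromList⁺ (∈-elements⁺ i∈))
  where
  into : ∀ {i} → i ∈ₛ fromList (elements S) → i ∈ₛ S
  into i∈ with j , j≡i , j∈ ← ∈-elements⁻ S (∈-fromList⁻ i∈) = subst (_∈ₛ S) (toℕ-injective j≡i) j∈

elements-fromList : ∀ {n D} → AllPairs _<_ D → All (_< n) D → elements {n} (fromList D) ≡ D
elements-fromList {n} {D} D↑ D<n = increasing-ext (elements-increasing (fromList {n} D)) D↑ into onto
  where
  into : ∀ {x} → x ∈ elements {n} (fromList D) → x ∈ D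
  into x∈ with i , i≡x , i∈ ← ∈-elements⁻ (fromList {n} D) x∈ = subst (_∈ D) i≡x (∈-fromList⁻ i∈)
  onto : ∀ {x} → x ∈ D → x ∈ elements {n} (fromList D)
  onto {x} x∈ = subst (_∈ elements {n} (fromList D)) (toℕ-fromℕ< x<n)
                 (∈-elements⁺ (∈-fromList⁺ (subst (_∈ D) (sym (toℕ-fromℕ< x<n)) x∈)))
    where
    x<n : x < n
    x<n = All.lookup D<n x∈

Cell : Set
Cell = ℕ × ℕ

East South : Cell → Cell → Set
East  (r , c) (r′ , c′) = r′ ≡ r × c′ ≡ suc c
South (r , c) (r′ , c′) = r′ ≡ suc r × c′ ≡ c

Valley Peak : Cell → Cell → Cell → Set
Valley p q s = South p q × East q s
Peak   p q s = East p q × South q s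

OnDiagonal Above : Cell → Set
OnDiagonal (r , c) = r ≡ c
Above      (r , c) = r ≤ c

Steps : List Cell → Set
Steps (p ∷ q ∷ ps) = (East p q ⊎ South p q) × Steps (q ∷ ps)
Steps _            = ⊤

Turns : (ℕ → ℕ → ℕ) → List Cell → Set
Turns M (p ∷ q ∷ s ∷ ps) =
  (Valley p q s → OnDiagonal q) × (Peak p q s → M (proj₁ q) (proj₂ q) ≡ 0) × Turns M (q ∷ s ∷ ps)
Turns M _ = ⊤

last : Cell → List Cell → Cell
last p []       = p
last p (q ∷ ps) = last q ps

EndsOnDiagonal : List Cell → Set
EndsOnDiagonal []       = ⊥
EndsOnDiagonal (p ∷ ps) = OnDiagonal p × OnDiagonal (last p ps)

IsValleyDyck : (ℕ → ℕ → ℕ) → List Cell → Set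
IsValleyDyck M π = EndsOnDiagonal π × Steps π × All Above π × Turns M π

-- Decision procedures.  They are built so that their boolean outcome is
-- literally the boolean test used in the definition of numValleyDyck.
east? : ∀ p q → Dec (East p q)
east? (r , c) (r′ , c′) = (r′ ≟ r) ×-dec (c′ ≟ suc c)

south? : ∀ p q → Dec (South p q)
south? (r , c) (r′ , c′) = (r′ ≟ suc r) ×-dec (c′ ≟ c)

valley? : ∀ p q s → Dec (Valley p q s)
valley? p q s = south? p q ×-dec east? q s

peak? : ∀ p q s → Dec (Peak p q s)
peak? p q s = east? p q ×-dec south? q s

onDiagonal? : ∀ p → Dec (OnDiagonal p)
onDiagonal? (r , c) = r ≟ c

above? : ∀ p → Dec (Above p)
above? (r , c) = r ≤? c

steps? : ∀ π → Dec (Steps π)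
steps? (p ∷ q ∷ ps) = (east? p q ⊎-dec south? p q) ×-dec steps? (q ∷ ps)
steps? []           = yes tt
steps? (p ∷ [])     = yes tt

turns? : ∀ M π → Dec (Turns M π)
turns? M (p ∷ q ∷ s ∷ ps) =
  (valley? p q s →-dec onDiagonal? q) ×-dec
  ((peak? p q s →-dec (M (proj₁ q) (proj₂ q) ≟ 0)) ×-dec turns? M (q ∷ s ∷ ps))
turns? M []           = yes tt
turns? M (p ∷ [])     = yes tt
turns? M (p ∷ q ∷ []) = yes tt

endsOnDiagonal? : ∀ π → Dec (EndsOnDiagonal π)
endsOnDiagonal? []       = no λ ()
endsOnDiagonal? (p ∷ ps) = onDiagonal? p ×-dec onDiagonal? (last p ps)

isValleyDyck? : ∀ M π → Dec (IsValleyDyck M π)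
isValleyDyck? M π = endsOnDiagonal? π ×-dec (steps? π ×-dec (All.all? above? π ×-dec turns? M π))

peaks : List Cell → ℕ
peaks (p ∷ q ∷ s ∷ ps) = (if does (peak? p q s) then 1 else 0) + peaks (q ∷ s ∷ ps)
peaks _                = 0

diagonal : List Cell → List ℕ
diagonal π = map proj₁ (filter onDiagonal? π)

peaks-peak : ∀ p q s ps → Peak p q s → peaks (p ∷ q ∷ s ∷ ps) ≡ suc (peaks (q ∷ s ∷ ps))
peaks-peak p q s ps pk = cong (λ b → (if b then 1 else 0) + peaks (q ∷ s ∷ ps)) (dec-true (peak? p q s) pk)

peaks-other : ∀ p q s ps → ¬ Peak p q s → peaks (p ∷ q ∷ s ∷ ps) ≡ peaks (q ∷ s ∷ ps)
peaks-other p q s ps ¬pk = cong (λ b → (if b then 1 else 0) + peaks (q ∷ s ∷ ps)) (dec-false (peak? p q s) ¬pk)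

diagonal-on : ∀ a π → diagonal ((a , a) ∷ π) ≡ a ∷ diagonal π
diagonal-on a π = cong (map proj₁) (filter-accept onDiagonal? refl)

diagonal-off : ∀ {r c} π → r ≢ c → diagonal ((r , c) ∷ π) ≡ diagonal π
diagonal-off π r≢c = cong (map proj₁) (filter-reject onDiagonal? r≢c)

-- A final segment p ∷ ps of a valley Dyck path (p need not be diagonal).
Segment : (ℕ → ℕ → ℕ) → List Cell → Set
Segment M []       = ⊥
Segment M (p ∷ ps) = Steps (p ∷ ps) × All Above (p ∷ ps) × Turns M (p ∷ ps) × OnDiagonal (last p ps)

segment-tail : ∀ {M p q ps} → Segment M (p ∷ q ∷ ps) → Segment M (q ∷ ps)
segment-tail {ps = []}     ((_ , st) , _ ∷ ab , _ , end)            = st , ab , tt , end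
segment-tail {ps = s ∷ ps} ((_ , st) , _ ∷ ab , (_ , _ , tu) , end) = st , ab , tu , end

isValleyDyck⇒segment : ∀ {M π} → IsValleyDyck M π → Segment M π
isValleyDyck⇒segment {π = p ∷ ps} ((_ , end) , st , ab , tu) = st , ab , tu , end

weight : Cell → ℕ
weight (r , c) = r + c

_≼_ : Cell → Cell → Set
(r , c) ≼ (r′ , c′) = r ≤ r′ × c ≤ c′

step-weight : ∀ {p q} → East p q ⊎ South p q → weight q ≡ suc (weight p)
step-weight {r , c} (inj₁ (refl , refl)) = +-suc r c
step-weight         (inj₂ (refl , refl)) = refl

step-≼ : ∀ {p q} → East p q ⊎ South p q → p ≼ q
step-≼ (inj₁ (refl , refl)) = ≤-refl , ℕ.n≤1+n _
step-≼ (inj₂ (refl , refl)) = ℕ.n≤1+n _ , ≤-refl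

≼-trans : ∀ {p q s} → p ≼ q → q ≼ s → p ≼ s
≼-trans (r≤ , c≤) (r≤′ , c≤′) = ℕ.≤-trans r≤ r≤′ , ℕ.≤-trans c≤ c≤′

steps-length : ∀ p ps → Steps (p ∷ ps) → length ps + weight p ≡ weight (last p ps)
steps-length p []       _          = refl
steps-length p (q ∷ ps) (st , sts) = begin
  suc (length ps) + weight p ≡⟨ +-suc (length ps) (weight p) ⟨
  length ps + suc (weight p) ≡⟨ cong (length ps +_) (step-weight st) ⟨
  length ps + weight q       ≡⟨ steps-length q ps sts ⟩
  weight (last q ps)         ∎
  where open ≡-Reasoning

steps-bounded : ∀ p ps → Steps (p ∷ ps) → All (_≼ last p ps) (p ∷ ps)
steps-bounded p []       _          = (≤-refl , ≤-refl) ∷ []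
steps-bounded p (q ∷ ps) (st , sts) with q≼ ∷ rest ← steps-bounded q ps sts =
  ≼-trans (step-≼ st) q≼ ∷ q≼ ∷ rest

-- The path through the diagonal cells a < b < ... (L lists those after a):
-- from (a , a) it runs east along row a to column b, then south along
-- column b down to (b , b), and so on.  east a c e L starts at (a , c)
-- with e east steps of the current run left, south r b s L starts at
-- (r , b) with s south steps left.  The first cell of a run is exposed
-- independently of its counter, so that runs can be matched cell by cell.
mutual
  fromDiagonal : ℕ → List ℕ → List Cell
  fromDiagonal a []      = []
  fromDiagonal a (b ∷ L) = east a (suc a) (b ∸ suc a) L

  east : ℕ → ℕ → ℕ → List ℕ → List Cell
  east a c e L = (a , c) ∷ eastTail a c e L

  eastTail : ℕ → ℕ → ℕ → List ℕ → List Cell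
  eastTail a c zero    L = south (suc a) c (c ∸ suc a) L
  eastTail a c (suc e) L = east a (suc c) e L

  south : ℕ → ℕ → ℕ → List ℕ → List Cell
  south r b s L = (r , b) ∷ southTail r b s L

  southTail : ℕ → ℕ → ℕ → List ℕ → List Cell
  southTail r b zero    L = fromDiagonal b L
  southTail r b (suc s) L = south (suc r) b s L

path : ℕ → List ℕ → List Cell
path a L = (a , a) ∷ fromDiagonal a L

trace : List ℕ → List Cell
trace []      = []
trace (a ∷ L) = path a L

-- consecutive diagonal cells of a valley Dyck path of M: increasing,
-- with a zero of M at the peak between them
Hop : (ℕ → ℕ → ℕ) → ℕ → ℕ → Set
Hop M a b = a < b × M a b ≡ 0

Admissible : (ℕ → ℕ → ℕ) → ℕ → List ℕ → Set
Admissible M a L = Linked (Hop M) (a ∷ L)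

Increasing : ℕ → List ℕ → Set
Increasing a L = Linked _<_ (a ∷ L)

admissible⇒increasing : ∀ {M a L} → Admissible M a L → Increasing a L
admissible⇒increasing = Linked.map proj₁

run-length : ∀ {e c b} → e + c ≡ b → b ∸ c ≡ e
run-length {e} {c} refl = m+n∸n≡m e c

run-end : ∀ {a c} → a ≤ c → c ∸ a + suc a ≡ suc c
run-end {a} {c} a≤c = trans (+-suc (c ∸ a) a) (cong suc (m∸n+n≡m a≤c))

run-step : ∀ {e c b} → suc e + c ≡ b → e + suc c ≡ b
run-step {e} {c} eq = trans (+-suc e c) eq

-- The
-- lemmas about local conditions (steps, turns, peaks) take the cell
-- preceding a run into account, since a turn involves three cells.
steps-east : ∀ a c e L → a ≤ c → Steps ((a , c) ∷ east a (suc c) e L)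
steps-south : ∀ r b s L → s + suc r ≡ b → Steps ((r , b) ∷ south (suc r) b s L)
steps-fromDiagonal : ∀ b L → Steps ((b , b) ∷ fromDiagonal b L)
steps-east a c zero    L a≤c = inj₁ (refl , refl) , steps-south a (suc c) (c ∸ a) L (run-end a≤c)
steps-east a c (suc e) L a≤c = inj₁ (refl , refl) , steps-east a (suc c) e L (ℕ.m≤n⇒m≤1+n a≤c)
steps-south r .(suc r) zero L refl = inj₂ (refl , refl) , steps-fromDiagonal (suc r) L
steps-south r b (suc s) L eq = inj₂ (refl , refl) , steps-south (suc r) b s L (run-step eq)
steps-fromDiagonal b []      = tt
steps-fromDiagonal b (d ∷ L) = steps-east b b (d ∸ suc b) L ≤-refl

below-end : ∀ {s r b} → s + suc r ≡ b → r < b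
below-end {s} {r} eq = subst (suc r ≤_) eq (ℕ.m≤n+m (suc r) s)

above-east : ∀ a c e L → a ≤ c → All Above ((a , c) ∷ east a (suc c) e L)
above-south : ∀ r b s L → s + suc r ≡ b → All Above ((r , b) ∷ south (suc r) b s L)
above-fromDiagonal : ∀ b L → All Above ((b , b) ∷ fromDiagonal b L)
above-east a c zero    L a≤c = a≤c ∷ above-south a (suc c) (c ∸ a) L (run-end a≤c)
above-east a c (suc e) L a≤c = a≤c ∷ above-east a (suc c) e L (ℕ.m≤n⇒m≤1+n a≤c)
above-south r .(suc r) zero L refl = ℕ.n≤1+n r ∷ above-fromDiagonal (suc r) L
above-south r b (suc s) L eq = ℕ.<⇒≤ (below-end {suc s} eq) ∷ above-south (suc r) b s L (run-step eq)
above-fromDiagonal b []      = ≤-refl ∷ []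
above-fromDiagonal b (d ∷ L) = above-east b b (d ∸ suc b) L ≤-refl

module _ (M : ℕ → ℕ → ℕ) where

  turns-east : ∀ a c e b L → e + suc c ≡ b → a ≤ c → M a b ≡ 0 → Admissible M b L →
               Turns M ((a , c) ∷ east a (suc c) e L)
  turns-south : ∀ r b s L → s + suc r ≡ b → Admissible M b L → Turns M ((r , b) ∷ south (suc r) b s L)
  turns-fromDiagonal : ∀ a L → Admissible M a L → Turns M ((a , a) ∷ fromDiagonal a L)
  turns-east a c zero .(suc c) L refl a≤c zero-at-peak adm =
    (λ { ((() , _) , _) }) , (λ _ → zero-at-peak) , turns-south a (suc c) (c ∸ a) L (run-end a≤c) adm
  turns-east a c (suc e) b L eq a≤c zero-at-peak adm =
    (λ { ((() , _) , _) }) , (λ { (_ , () , _) }) ,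
    turns-east a (suc c) e b L (run-step eq) (ℕ.m≤n⇒m≤1+n a≤c) zero-at-peak adm
  turns-south r .(suc r) zero []      refl _                   = tt
  turns-south r .(suc r) zero (d ∷ L) refl ((r<d , m0) ∷ adm) =
    (λ _ → refl) , (λ { ((() , _) , _) }) ,
    turns-east (suc r) (suc r) (d ∸ suc (suc r)) d L (m∸n+n≡m r<d) ≤-refl m0 adm
  turns-south r b (suc s) L eq adm =
    (λ { (_ , () , _) }) , (λ { ((() , _) , _) }) , turns-south (suc r) b s L (run-step eq) adm
  turns-fromDiagonal a []      _                    = tt
  turns-fromDiagonal a (d ∷ L) ((a<d , m0) ∷ adm) = turns-east a a (d ∸ suc a) d L (m∸n+n≡m a<d) ≤-refl m0 adm

peaks-east : ∀ a c e L → a ≤ c → peaks ((a , c) ∷ east a (suc c) e L) ≡ suc (length L)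
peaks-south : ∀ r b s L → s + suc r ≡ b → peaks ((r , b) ∷ south (suc r) b s L) ≡ length L
peaks-fromDiagonal : ∀ a L → peaks ((a , a) ∷ fromDiagonal a L) ≡ length L
peaks-east a c zero L a≤c =
  trans (peaks-peak (a , c) (a , suc c) (suc a , suc c) (southTail (suc a) (suc c) (c ∸ a) L)
                    ((refl , refl) , (refl , refl)))
        (cong suc (peaks-south a (suc c) (c ∸ a) L (run-end a≤c)))
peaks-east a c (suc e) L a≤c =
  trans (peaks-other (a , c) (a , suc c) (a , suc (suc c)) (eastTail a (suc (suc c)) e L) λ { (_ , () , _) })
        (peaks-east a (suc c) e L (ℕ.m≤n⇒m≤1+n a≤c))
peaks-south r .(suc r) zero []      refl = refl
peaks-south r .(suc r) zero (d ∷ L) refl =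
  trans (peaks-other (r , suc r) (suc r , suc r) (suc r , suc (suc r)) (eastTail (suc r) (suc (suc r)) (d ∸ suc (suc r)) L)
                     λ { ((() , _) , _) })
        (peaks-east (suc r) (suc r) (d ∸ suc (suc r)) L ≤-refl)
peaks-south r b (suc s) L eq =
  trans (peaks-other (r , b) (suc r , b) (suc (suc r) , b) (southTail (suc (suc r)) b s L) λ { ((() , _) , _) })
        (peaks-south (suc r) b s L (run-step eq))
peaks-fromDiagonal a []      = refl
peaks-fromDiagonal a (d ∷ L) = peaks-east a a (d ∸ suc a) L ≤-refl

final : ℕ → List ℕ → ℕ
final b []      = b
final b (d ∷ L) = final d L

final-∈ : ∀ a L → final a L ∈ a ∷ L
final-∈ a []      = here refl
final-∈ a (d ∷ L) = there (final-∈ d L)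

last-east : ∀ p a c e b L → a < c → e + c ≡ b → Increasing b L → last p (east a c e L) ≡ (final b L , final b L)
last-south : ∀ p r b s L → s + r ≡ b → Increasing b L → last p (south r b s L) ≡ (final b L , final b L)
last-fromDiagonal : ∀ b L → Increasing b L → last (b , b) (fromDiagonal b L) ≡ (final b L , final b L)
last-east p a c zero .c L a<c refl inc = last-south (a , c) (suc a) c (c ∸ suc a) L (m∸n+n≡m a<c) inc
last-east p a c (suc e) b L a<c eq inc = last-east (a , c) a (suc c) e b L (ℕ.m<n⇒m<1+n a<c) (run-step eq) inc
last-south p r .r zero L refl inc = last-fromDiagonal r L inc
last-south p r b (suc s) L eq inc = last-south (r , b) (suc r) b s L (run-step eq) inc
last-fromDiagonal b []      _           = refl
last-fromDiagonal b (d ∷ L) (b<d ∷ inc) = last-east (b , b) b (suc b) (d ∸ suc b) d L (ℕ.n<1+n b) (m∸n+n≡m b<d) inc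

diagonal-east : ∀ a c e b L → a < c → e + c ≡ b → Increasing b L → diagonal (east a c e L) ≡ b ∷ L
diagonal-south : ∀ r b s L → s + r ≡ b → Increasing b L → diagonal (south r b s L) ≡ b ∷ L
diagonal-fromDiagonal : ∀ b L → Increasing b L → diagonal (fromDiagonal b L) ≡ L
diagonal-east a c zero .c L a<c refl inc =
  trans (diagonal-off (eastTail a c zero L) (ℕ.<⇒≢ a<c)) (diagonal-south (suc a) c (c ∸ suc a) L (m∸n+n≡m a<c) inc)
diagonal-east a c (suc e) b L a<c eq inc =
  trans (diagonal-off (eastTail a c (suc e) L) (ℕ.<⇒≢ a<c))
        (diagonal-east a (suc c) e b L (ℕ.m<n⇒m<1+n a<c) (run-step eq) inc)
diagonal-south r .r zero L refl inc = trans (diagonal-on r (fromDiagonal r L)) (cong (r ∷_) (diagonal-fromDiagonal r L inc))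
diagonal-south r b (suc s) L eq inc =
  trans (diagonal-off (southTail r b (suc s) L) (ℕ.<⇒≢ (below-end {s} (run-step eq))))
        (diagonal-south (suc r) b s L (run-step eq) inc)
diagonal-fromDiagonal b []      _           = refl
diagonal-fromDiagonal b (d ∷ L) (b<d ∷ inc) = diagonal-east b (suc b) (d ∸ suc b) d L (ℕ.n<1+n b) (m∸n+n≡m b<d) inc

path-isValleyDyck : ∀ M a L → Admissible M a L → IsValleyDyck M (path a L)
path-isValleyDyck M a L adm =
  (refl , subst OnDiagonal (sym (last-fromDiagonal a L (admissible⇒increasing adm))) refl) ,
  steps-fromDiagonal a L , above-fromDiagonal a L , turns-fromDiagonal M a L adm

path-diagonal : ∀ a L → Increasing a L → diagonal (path a L) ≡ a ∷ L
path-diagonal a L inc = trans (diagonal-on a (fromDiagonal a L)) (cong (a ∷_) (diagonal-fromDiagonal a L inc))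

-- A final segment is read
-- off cell by cell: after a diagonal cell only an east step is possible
-- (staying above the diagonal), an east run ends at a peak, and a south
-- run can only turn east on the diagonal.
module _ (M : ℕ → ℕ → ℕ) where

  parse-diagonal : ∀ a rest → Segment M ((a , a) ∷ rest) → ∃ λ L → Admissible M a L × rest ≡ fromDiagonal a L
  parse-east : ∀ a c rest → a ≤ c → Segment M ((a , c) ∷ (a , suc c) ∷ rest) →
    ∃₂ λ e b → ∃ λ L → e + suc c ≡ b × Hop M a b × Admissible M b L × rest ≡ eastTail a (suc c) e L
  parse-south : ∀ r b rest → suc r ≤ b → Segment M ((r , b) ∷ (suc r , b) ∷ rest) →
    ∃₂ λ s L → s + suc r ≡ b × Admissible M b L × rest ≡ southTail (suc r) b s L

  parse-diagonal a [] _ = [] , [-] , refl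
  parse-diagonal a ((x , y) ∷ rest) seg@((step , _) , _ ∷ above , _) with step
  ... | inj₂ (refl , refl) = contradiction (All.head above) (ℕ.n≮n a)
  ... | inj₁ (refl , refl) with e , b , L , e+1+a≡b , hop , adm , rest≡ ← parse-east a a rest ≤-refl seg =
    b ∷ L , hop ∷ adm ,
    cong ((a , suc a) ∷_) (trans rest≡ (cong (λ e → eastTail a (suc a) e L) (sym (run-length e+1+a≡b))))

  parse-east a c [] a≤c (_ , _ , _ , a≡1+c) = contradiction (subst (_≤ c) a≡1+c a≤c) (ℕ.n≮n c)
  parse-east a c ((x , y) ∷ rest) a≤c seg@((_ , step , _) , _ , (_ , peak⇒0 , _) , _) with step
  ... | inj₁ (refl , refl)
    with e , b , L , eq , hop , adm , rest≡ ← parse-east a (suc c) rest (ℕ.m≤n⇒m≤1+n a≤c) (segment-tail seg) =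
    suc e , b , L , trans (sym (+-suc e (suc c))) eq , hop , adm , cong ((a , suc (suc c)) ∷_) rest≡
  ... | inj₂ (refl , refl)
    with s , L , eq , adm , rest≡ ← parse-south a (suc c) rest (s≤s a≤c) (segment-tail seg) =
    0 , suc c , L , refl , (s≤s a≤c , peak⇒0 ((refl , refl) , (refl , refl))) , adm ,
    cong ((suc a , suc c) ∷_) (trans rest≡ (cong (λ s → southTail (suc a) (suc c) s L) (sym (run-length {s} {suc a} eq))))

  parse-south r b rest 1+r≤b seg with m≤n⇒m<n∨m≡n 1+r≤b
  parse-south r .(suc r) rest _ seg | inj₂ refl
    with L , adm , rest≡ ← parse-diagonal (suc r) rest (segment-tail seg) = 0 , L , refl , adm , rest≡
  parse-south r b [] _ (_ , _ , _ , 1+r≡b) | inj₁ 1+r<b = contradiction 1+r≡b (ℕ.<⇒≢ 1+r<b)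
  parse-south r b ((x , y) ∷ rest) _ seg@((_ , step , _) , _ , (valley⇒diagonal , _ , _) , _) | inj₁ 1+r<b
    with step
  ... | inj₁ (refl , refl) = contradiction (valley⇒diagonal ((refl , refl) , (refl , refl))) (ℕ.<⇒≢ 1+r<b)
  ... | inj₂ (refl , refl) with s , L , eq , adm , rest≡ ← parse-south (suc r) b rest 1+r<b (segment-tail seg) =
    suc s , L , trans (sym (+-suc s (suc r))) eq , adm , cong ((suc (suc r) , b) ∷_) rest≡

  parse : ∀ π → IsValleyDyck M π → ∃₂ λ a L → Admissible M a L × π ≡ path a L
  parse []               (() , _)
  parse ((x , y) ∷ rest) vd@((x≡y , _) , _) with refl ← x≡y
    with L , adm , rest≡ ← parse-diagonal x rest (isValleyDyck⇒segment vd) = x , L , adm , cong ((x , x) ∷_) rest≡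

module Transfer {N : ℕ} .{{_ : NonZero N}} where

  coordinates : Pos N → Cell
  coordinates (r , c) = toℕ r , toℕ c

  cell : Cell → Pos N
  cell (x , y) = x mod N , y mod N

  extend : (Fin N → Fin N → ℕ) → ℕ → ℕ → ℕ
  extend M x y = M (x mod N) (y mod N)

  toℕ-mod : ∀ {x} → x < N → toℕ (x mod N) ≡ x
  toℕ-mod {x} x<N = trans (toℕ-fromℕ< (m%n<n x N)) (m<n⇒m%n≡m x<N)

  mod-toℕ : ∀ (i : Fin N) → toℕ i mod N ≡ i
  mod-toℕ i = toℕ-injective (toℕ-mod (toℕ<n i))

  InRange : Cell → Set
  InRange (x , y) = x < N × y < N

  cell-coordinates : ∀ π → map cell (map coordinates π) ≡ π
  cell-coordinates π =
    trans (sym (map-∘ π)) (map-id-local (All.universal (λ (r , c) → cong₂ _,_ (mod-toℕ r) (mod-toℕ c)) π))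

  coordinates-cell : ∀ {π} → All InRange π → map coordinates (map cell π) ≡ π
  coordinates-cell {π} inRange =
    trans (sym (map-∘ π)) (map-id-local (All.map (λ (x<N , y<N) → cong₂ _,_ (toℕ-mod x<N) (toℕ-mod y<N)) inRange))

  steps-coordinates : ∀ π → stepsOK π ≡ does (steps? (map coordinates π))
  steps-coordinates (p ∷ q ∷ ps) = cong (_ ∧_) (steps-coordinates (q ∷ ps))
  steps-coordinates []           = refl
  steps-coordinates (p ∷ [])     = refl

  above-coordinates : ∀ π → allAbove π ≡ does (All.all? above? (map coordinates π))
  above-coordinates []       = refl
  above-coordinates (p ∷ ps) = cong (_ ∧_) (above-coordinates ps)

  last-coordinates : ∀ p ps → coordinates (lastPos p ps) ≡ last (coordinates p) (map coordinates ps)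
  last-coordinates p []       = refl
  last-coordinates p (q ∷ ps) = last-coordinates q ps

  ends-coordinates : ∀ π → endsOnDiag π ≡ does (endsOnDiagonal? (map coordinates π))
  ends-coordinates []       = refl
  ends-coordinates (p ∷ ps) = cong (λ q → onDiag p ∧ does (onDiagonal? q)) (last-coordinates p ps)

  turns-coordinates : ∀ M π → turnsOK M π ≡ does (turns? (extend M) (map coordinates π))
  turns-coordinates M (p ∷ q@(r , c) ∷ s ∷ ps) =
    cong₂ (λ m rest → (not (isValley p q s) ∨ onDiag q) ∧ ((not (isPeak p q s) ∨ (m ≡ᵇ 0)) ∧ rest))
          (cong₂ M (sym (mod-toℕ r)) (sym (mod-toℕ c))) (turns-coordinates M (q ∷ s ∷ ps))
  turns-coordinates M []           = refl
  turns-coordinates M (p ∷ [])     = refl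
  turns-coordinates M (p ∷ q ∷ []) = refl

  isValleyDyck-coordinates : ∀ M π → T (isValleyDyck M π) ⇔ IsValleyDyck (extend M) (map coordinates π)
  isValleyDyck-coordinates M π =
    subst (λ b → T b ⇔ IsValleyDyck (extend M) (map coordinates π)) (sym same-test)
          (T-does (isValleyDyck? (extend M) (map coordinates π)))
    where
    same-test : isValleyDyck M π ≡ does (isValleyDyck? (extend M) (map coordinates π))
    same-test = cong₂ _∧_ (ends-coordinates π)
                  (cong₂ _∧_ (steps-coordinates π) (cong₂ _∧_ (above-coordinates π) (turns-coordinates M π)))

  peaks-coordinates : ∀ π → numPeaks π ≡ peaks (map coordinates π)
  peaks-coordinates (p ∷ q ∷ s ∷ ps) = cong (_ +_) (peaks-coordinates (q ∷ s ∷ ps))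
  peaks-coordinates []               = refl
  peaks-coordinates (p ∷ [])         = refl
  peaks-coordinates (p ∷ q ∷ [])     = refl

  diagonal-bounded : ∀ π → All (_< N) (diagonal (map coordinates π))
  diagonal-bounded π = All.tabulate bounded
    where
    bounded : ∀ {x} → x ∈ diagonal (map coordinates π) → x < N
    bounded x∈ with _ , p∈ , refl ← ∈-map⁻ proj₁ x∈ with p∈′ , _ ← ∈-filter⁻ onDiagonal? {xs = map coordinates π} p∈
               with (r , _) , _ , refl ← ∈-map⁻ coordinates {xs = π} p∈′ = toℕ<n r

module Correspondence {N : ℕ} .{{_ : NonZero N}} (P : NatLabeledPoset N) where
  open NatLabeledPoset P
  open Transfer {N}
  private module PO = IsDecPartialOrder isDecPO

  A : ℕ → ℕ → ℕ
  A = extend antiadj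

  antiadj-zero⁺ : ∀ {i j} → i <P j → antiadj i j ≡ 0
  antiadj-zero⁺ {i} {j} i<j = cong (λ b → if b then 0 else 1) (dec-true (i <P? j) i<j)

  antiadj-zero⁻ : ∀ {i j} → antiadj i j ≡ 0 → i <P j
  antiadj-zero⁻ {i} {j} = indicator-zero (i <P? j)
    where
    indicator-zero : ∀ {B : Set} (d : Dec B) → (if does d then 0 else 1) ≡ 0 → B
    indicator-zero (yes b) _ = b

  <P-trans : ∀ {i j k} → i <P j → j <P k → i <P k
  <P-trans (i≤j , i≢j) (j≤k , j≢k) =
    PO.trans i≤j j≤k , λ { refl → i≢j (PO.antisym i≤j j≤k) }

  -- Each hop of an admissible sequence is a relation a <P b, so by
  -- transitivity any two entries are related, and those below N form
  -- a chain.
  admissible-related : ∀ {a L} → Admissible A a L → AllPairs (λ x y → (x mod N) <P (y mod N)) (a ∷ L)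
  admissible-related adm = Linked⇒AllPairs <P-trans (Linked.map (λ (_ , a≡0) → antiadj-zero⁻ a≡0) adm)

  admissible-chain : ∀ {a L} → Admissible A a L → IsChain (fromList (a ∷ L))
  admissible-chain adm i j i∈ j∈ with allPairs-related (admissible-related adm) (∈-fromList⁻ i∈) (∈-fromList⁻ j∈)
  ... | inj₁ i≡j        = inj₁ (PO.reflexive (toℕ-injective i≡j))
  ... | inj₂ (inj₁ i<j) = inj₁ (proj₁ (subst₂ _<P_ (mod-toℕ i) (mod-toℕ j) i<j))
  ... | inj₂ (inj₂ j<i) = inj₂ (proj₁ (subst₂ _<P_ (mod-toℕ j) (mod-toℕ i) j<i))

  -- Conversely, since P is naturally labeled, two members i < j of a
  -- chain satisfy i <P j, i.e. they form a hop.
  chain-hop : ∀ {S i j} → IsChain S → i ∈ₛ S → j ∈ₛ S → toℕ i < toℕ j → Hop A (toℕ i) (toℕ j)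
  chain-hop {i = i} {j} chain i∈ j∈ i<j =
    i<j , subst₂ (λ x y → antiadj x y ≡ 0) (sym (mod-toℕ i)) (sym (mod-toℕ j)) (antiadj-zero⁺ (i≤j , i≢j))
    where
    i≤j : i ≤P j
    i≤j with chain i j i∈ j∈
    ... | inj₁ i≤j = i≤j
    ... | inj₂ j≤i = contradiction (natural j≤i) (ℕ.<⇒≱ i<j)
    i≢j : ¬ i ≡ j
    i≢j refl = ℕ.<-irrefl refl i<j

  chain-admissible : ∀ {S} → IsChain S → ∀ {a L} → AllPairs _<_ (a ∷ L) → All (_∈ elements S) (a ∷ L) →
                     Admissible A a L
  chain-admissible chain {L = []}    _                  _                  = [-]
  chain-admissible {S} chain {L = b ∷ L} ((a<b ∷ _) ∷ inc) (a∈ ∷ b∈ ∷ rest∈)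
    with i , refl , i∈ ← ∈-elements⁻ S a∈ | j , refl , j∈ ← ∈-elements⁻ S b∈ =
    chain-hop chain i∈ j∈ a<b ∷ chain-admissible chain inc (b∈ ∷ rest∈)

  -- The path through an increasing sequence below N stays inside the
  -- N × N matrix and has fewer than 2N cells, since its last cell
  -- bounds all others and each step adds one to r + c.
  path-inRange : ∀ a L → Increasing a L → All (_< N) (a ∷ L) → All InRange (path a L)
  path-inRange a L inc bounded =
    All.map (λ (r≤ , c≤) → ℕ.≤-<-trans r≤ ℓ<N , ℕ.≤-<-trans c≤ ℓ<N)
      (subst (λ q → All (_≼ q) (path a L)) (last-fromDiagonal a L inc)
             (steps-bounded (a , a) (fromDiagonal a L) (steps-fromDiagonal a L)))
    where
    ℓ<N : final a L < N
    ℓ<N = All.lookup bounded (final-∈ a L)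

  path-length : ∀ a L → Increasing a L → final a L < N → length (path a L) ≤ 2 * N
  path-length a L inc ℓ<N = begin
    suc (length (fromDiagonal a L))           ≤⟨ s≤s (ℕ.m≤m+n _ (a + a)) ⟩
    suc (length (fromDiagonal a L) + (a + a)) ≡⟨ cong suc (steps-length (a , a) _ (steps-fromDiagonal a L)) ⟩
    suc (weight (last (a , a) (fromDiagonal a L))) ≡⟨ cong (suc ∘ weight) (last-fromDiagonal a L inc) ⟩
    suc (ℓ + ℓ)                               ≤⟨ ℕ.+-mono-≤ ℓ<N (ℕ.<⇒≤ ℓ<N) ⟩
    N + N                                     ≡⟨ cong (N +_) (ℕ.+-identityʳ N) ⟨
    2 * N                                     ∎
    where
    open ℕ.≤-Reasoning
    ℓ : ℕ
    ℓ = final a L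

  toPath : Subset N → List (Pos N)
  toPath S = map cell (trace (elements S))

  toChain : List (Pos N) → Subset N
  toChain π = fromList (diagonal (map coordinates π))

  chain-sequence : ∀ k {S} → ∣ S ∣ ≡ suc k → IsChain S →
    ∃₂ λ a L → elements S ≡ a ∷ L × length L ≡ k × Admissible A a L × All (_< N) (a ∷ L)
  chain-sequence k {S} size chain with a , L , elements≡ , length≡ ← sized-elements S size =
    a , L , elements≡ , length≡ ,
    chain-admissible chain (subst (AllPairs _<_) elements≡ (elements-increasing S))
      (subst (All (_∈ elements S)) elements≡ (All.tabulate (λ x∈ → x∈))) ,
    subst (All (_< N)) elements≡ (elements-bounded S)

  chain→path : ∀ k {S} → ∣ S ∣ ≡ suc k × IsChain S →
    toPath S ∈ listsUpTo (2 * N) (allPos N) × T (isValleyDyck antiadj (toPath S) ∧ (numPeaks (toPath S) ≡ᵇ k)) ×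
    toChain (toPath S) ≡ S
  chain→path k {S} (size , chain) with a , L , elements≡ , length≡ , adm , bounded ← chain-sequence k size chain =
    listed , Equivalence.from T-∧ (valleyDyck , peaks≡k) , inverse
    where
    toPath≡ : toPath S ≡ map cell (path a L)
    toPath≡ = cong (λ D → map cell (trace D)) elements≡
    coordinates≡ : map coordinates (toPath S) ≡ path a L
    coordinates≡ = trans (cong (map coordinates) toPath≡)
      (coordinates-cell (path-inRange a L (admissible⇒increasing adm) bounded))
    listed : toPath S ∈ listsUpTo (2 * N) (allPos N)
    listed = listsUpTo-complete (2 * N) (allPos N) (toPath S)
      (subst (_≤ 2 * N) (sym (trans (cong length toPath≡) (length-map cell (path a L))))
        (path-length a L (admissible⇒increasing adm) (All.lookup bounded (final-∈ a L))))
      (All.universal (allPos-complete N) (toPath S))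
    valleyDyck : T (isValleyDyck antiadj (toPath S))
    valleyDyck = Equivalence.from (isValleyDyck-coordinates antiadj (toPath S))
      (subst (IsValleyDyck A) (sym coordinates≡) (path-isValleyDyck A a L adm))
    peaks≡k : T (numPeaks (toPath S) ≡ᵇ k)
    peaks≡k = ℕ.≡⇒≡ᵇ _ _ (begin
      numPeaks (toPath S)              ≡⟨ peaks-coordinates (toPath S) ⟩
      peaks (map coordinates (toPath S)) ≡⟨ cong peaks coordinates≡ ⟩
      peaks (path a L)                 ≡⟨ peaks-fromDiagonal a L ⟩
      length L                         ≡⟨ length≡ ⟩
      k                                ∎)
      where open ≡-Reasoning
    inverse : toChain (toPath S) ≡ S
    inverse = begin
      fromList (diagonal (map coordinates (toPath S))) ≡⟨ cong (fromList ∘ diagonal) coordinates≡ ⟩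
      fromList (diagonal (path a L))                   ≡⟨ cong fromList (path-diagonal a L (admissible⇒increasing adm)) ⟩
      fromList (a ∷ L)                                 ≡⟨ cong fromList elements≡ ⟨
      fromList (elements S)                            ≡⟨ fromList-elements S ⟩
      S                                                ∎
      where open ≡-Reasoning

  path→chain : ∀ k {π} → T (isValleyDyck antiadj π ∧ (numPeaks π ≡ᵇ k)) →
    toChain π ∈ allSubsets N × (∣ toChain π ∣ ≡ suc k × IsChain (toChain π)) × toPath (toChain π) ≡ π
  path→chain k {π} t with valleyDyck , peaks≡k ← Equivalence.to T-∧ t
    with a , L , adm , coordinates≡ ←
         parse A (map coordinates π) (Equivalence.to (isValleyDyck-coordinates antiadj π) valleyDyck) =
    allSubsets-complete N (toChain π) , (size , chain) , inverse
    where
    diagonal≡ : diagonal (map coordinates π) ≡ a ∷ L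
    diagonal≡ = trans (cong diagonal coordinates≡) (path-diagonal a L (admissible⇒increasing adm))
    elements≡ : elements (toChain π) ≡ a ∷ L
    elements≡ = trans (cong (elements ∘ fromList {N}) diagonal≡)
      (elements-fromList (Linked⇒AllPairs ℕ.<-trans (admissible⇒increasing adm))
        (subst (All (_< N)) diagonal≡ (diagonal-bounded π)))
    size : ∣ toChain π ∣ ≡ suc k
    size = begin
      ∣ toChain π ∣                 ≡⟨ size-elements (toChain π) ⟩
      length (elements (toChain π)) ≡⟨ cong length elements≡ ⟩
      suc (length L)                ≡⟨ cong suc (peaks-fromDiagonal a L) ⟨
      suc (peaks (path a L))        ≡⟨ cong (suc ∘ peaks) coordinates≡ ⟨
      suc (peaks (map coordinates π)) ≡⟨ cong suc (peaks-coordinates π) ⟨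
      suc (numPeaks π)              ≡⟨ cong suc (ℕ.≡ᵇ⇒≡ _ _ peaks≡k) ⟩
      suc k                         ∎
      where open ≡-Reasoning
    chain : IsChain (toChain π)
    chain = subst IsChain (cong fromList (sym diagonal≡)) (admissible-chain adm)
    inverse : toPath (toChain π) ≡ π
    inverse = begin
      map cell (trace (elements (toChain π))) ≡⟨ cong (map cell ∘ trace) elements≡ ⟩
      map cell (path a L)                     ≡⟨ cong (map cell) coordinates≡ ⟨
      map cell (map coordinates π)            ≡⟨ cell-coordinates π ⟩
      π                                       ∎
      where open ≡-Reasoning

  chains-paths : ∀ k → fvec P k ≡ numValleyDyck antiadj k
  chains-paths k = count-bijection _ _ (allSubsets-unique N) (listsUpTo-unique (2 * N) (allPos-unique N))
    toPath toChain (λ _ → chain→path k) (λ _ → path→chain k)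

  singletons : fvec P 0 ≡ N
  singletons = begin
    fvec P 0                         ≡⟨ count-bijection _ (_<? N) (allSubsets-unique N) (Unique.upTo⁺ N) least singleton
                                          least-ok singleton-ok ⟩
    length (filter (_<? N) (upTo N)) ≡⟨ cong length (filter-all (_<? N) (All.tabulate ∈-upTo⁻)) ⟩
    length (upTo N)                  ≡⟨ length-upTo N ⟩
    N                                ∎
    where
    open ≡-Reasoning
    least : Subset N → ℕ
    least S = fromMaybe 0 (head (elements S))
    singleton : ℕ → Subset N
    singleton x = fromList (x ∷ [])
    least-ok : ∀ {S} → S ∈ allSubsets N → ∣ S ∣ ≡ 1 × IsChain S →
               least S ∈ upTo N × least S < N × singleton (least S) ≡ S
    least-ok {S} _ (size , _) with x , elements≡ ← size-one S size rewrite elements≡ =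
      ∈-upTo⁺ x<N , x<N , trans (cong fromList (sym elements≡)) (fromList-elements S)
      where
      x<N : x < N
      x<N = All.head (subst (All (_< N)) elements≡ (elements-bounded S))
    singleton-ok : ∀ {x} → x ∈ upTo N → x < N →
                   singleton x ∈ allSubsets N × (∣ singleton x ∣ ≡ 1 × IsChain (singleton x)) × least (singleton x) ≡ x
    singleton-ok {x} _ x<N = allSubsets-complete N (singleton x) ,
      (trans (size-elements (singleton x)) (cong length elements≡) , admissible-chain [-]) ,
      cong (fromMaybe 0 ∘ head) elements≡
      where
      elements≡ : elements {N} (singleton x) ≡ x ∷ []
      elements≡ = elements-fromList ([] ∷ []) (x<N ∷ [])

proposition8p2 : (n : ℕ) (P : NatLabeledPoset n) →
    (fvec P 0 ≡ n) ×
    ((k : ℕ) → 1 ≤ k → k < n →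
    fvec P k ≡ numValleyDyck (NatLabeledPoset.antiadj P) k)
proposition8p2 zero    P = refl , λ _ _ ()
proposition8p2 (suc m) P = singletons , λ k _ _ → chains-paths k
  where open Correspondence P
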